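{- Let $\ast_c$ be a choice revision on $K$. Then $\ast_c$ satisfies $\ast_c$-closure, $\ast_c$-relative success, $\ast_c$-regularity, $\ast_c$-confirmation and $\ast_c$-reciprocity iff there is a multi-believability relation $\preceq_{c}$ satisfying $\preceq_{c}$-transitivity, $\preceq_{c}$-weak coupling, $\preceq_{c}$-counter dominance, $\preceq_{c}$-minimality and $\preceq_{c}$-union such that for every finite $A$: $K \ast_c A = \{\varphi \mid A \simeq_{c} \{\psi\wedge\varphi \mid \psi\in A\}\}$ if $A \prec_{c} \emptyset$, and $K \ast_c A = K$ otherwise.
   Context: $\mathcal{L}$ is a propositional language (not necessarily finite) with consequence operation $\mathrm{Cn}$ (supraclassical, compact, deduction property); $X\vdash\varphi$ means $\varphi\in\mathrm{Cn}(X)$. $K$ is a fixed consistent belief set ($K=\mathrm{Cn}(K)$). A choice revision $\ast_c$ on $K$ maps each finite $A\subseteq\mathcal{L}$ to a set $K\ast_c A$. Postulates (for finite $A,B$): closure: $\mathrm{Cn}(K\ast_c A)=K\ast_c A$; relative success: $K\ast_c A=K$ or $A\cap(K\ast_c A)\neq\emptyset$; regularity: if $A\cap(K\ast_c B)\neq\emptyset$ then $A\cap(K\ast_c A)\neq\emptyset$; confirmation: if $A\cap K\neq\emptyset$ then $K\ast_c A=K$; reciprocity: if $(K\ast_c A)\cap B\neq\emptyset$ and $(K\ast_c B)\cap A\neq\emptyset$ then $K\ast_c A=K\ast_c B$. A multi-believability relation $\preceq_{c}$ is a binary relation on finite subsets of $\mathcal{L}$ (symmetric part $\simeq_{c}$,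 strict part $\prec_{c}$; $\{\varphi\}$ written $\varphi$). Postulates (for finite $A,B,C$): transitivity: if $A\preceq_{c}B$ and $B\preceq_{c}C$ then $A\preceq_{c}C$; weak coupling: if $A\simeq_{c}\{\varphi\wedge\psi\mid\varphi\in A,\psi\in B\}$ and $A\simeq_{c}\{\varphi\wedge\chi\mid\varphi\in A,\chi\in C\}$ then $A\simeq_{c}\{(\varphi\wedge\psi)\wedge\chi\mid\varphi\in A,\psi\in B,\chi\in C\}$; counter dominance: if for every $\varphi\in B$ there is $\psi\in A$ with $\varphi\vdash\psi$ then $A\preceq_{c}B$; minimality: $A\preceq_{c}B$ for all $B$ iff $A\cap K\neq\emptyset$; union: $A\preceq_{c}A\cup B$ or $B\preceq_{c}A\cup B$. -}

module Defs where

open import Data.Bool using (Bool; true; false; not; _∧_; _∨_)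
open import Data.List using (List; []; _∷_; map; concatMap; _++_)
open import Data.List.Membership.Propositional using (_∈_)
open import Data.Sum using (_⊎_)
open import Data.Product using (Σ; ∃; _×_; _,_)
open import Relation.Binary.PropositionalEquality using (_≡_)
open import Relation.Nullary using (¬_)

data Form (At : Set) : Set where
  atom  : At → Form At
  ⊥f    : Form At
  ¬f_   : Form At → Form At
  _∧f_  : Form At → Form At → Form At
  _∨f_  : Form At → Form At → Form At
  _⇒f_  : Form At → Form At → Form At

infixr 6 _∧f_
infixr 5 _∨f_
infixr 4 _⇒f_

eval : {At : Set} → (At → Bool) → Form At → Bool
eval v (atom p) = v p
eval v ⊥f = false
eval v (¬f φ) = not (eval v φ)
eval v (φ ∧f ψ) = eval v φ ∧ eval v ψ
eval v (φ ∨f ψ) = eval v φ ∨ eval v ψ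
eval v (φ ⇒f ψ) = not (eval v φ) ∨ eval v ψ

FSet : Set → Set₁
FSet At = Form At → Set

_⊆_ : {At : Set} → FSet At → FSet At → Set
X ⊆ Y = ∀ φ → X φ → Y φ

_≐_ : {At : Set} → FSet At → FSet At → Set
X ≐ Y = X ⊆ Y × Y ⊆ X

⟦_⟧ : {At : Set} → List (Form At) → FSet At
⟦ A ⟧ φ = φ ∈ A

_⊕_ : {At : Set} → FSet At → Form At → FSet At
(X ⊕ ψ) φ = X φ ⊎ (φ ≡ ψ)

_⊨_ : {At : Set} → FSet At → Form At → Set
X ⊨ φ = ∀ v → (∀ ψ → X ψ → eval v ψ ≡ true) → eval v φ ≡ true

record IsConsequence {At : Set} (Cn : FSet At → FSet At) : Set₁ where
  field
    inclusion     : ∀ X → X ⊆ Cn X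
    monotony      : ∀ X Y → X ⊆ Y → Cn X ⊆ Cn Y
    iteration     : ∀ X → Cn (Cn X) ⊆ Cn X
    supraclassical : ∀ X φ → X ⊨ φ → Cn X φ
    compact       : ∀ X φ → Cn X φ →
                    Σ (List (Form At)) (λ Y → (⟦ Y ⟧ ⊆ X) × Cn ⟦ Y ⟧ φ)
    deduction₁    : ∀ X ψ φ → Cn (X ⊕ ψ) φ → Cn X (ψ ⇒f φ)
    deduction₂    : ∀ X ψ φ → Cn X (ψ ⇒f φ) → Cn (X ⊕ ψ) φ

Meets : {At : Set} → List (Form At) → FSet At → Set
Meets A X = ∃ λ φ → φ ∈ A × X φ

module Revision {At : Set} (Cn : FSet At → FSet At) (K : FSet At)
                (rev : List (Form At) → FSet At) where

  Closure : Set
  Closure = ∀ A → Cn (rev A) ≐ rev A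

  RelativeSuccess : Set
  RelativeSuccess = ∀ A → (rev A ≐ K) ⊎ Meets A (rev A)

  Regularity : Set
  Regularity = ∀ A B → Meets A (rev B) → Meets A (rev A)

  Confirmation : Set
  Confirmation = ∀ A → Meets A K → rev A ≐ K

  Reciprocity : Set
  Reciprocity = ∀ A B → Meets B (rev A) → Meets A (rev B) → rev A ≐ rev B

  AllPostulates : Set
  AllPostulates = Closure × RelativeSuccess × Regularity × Confirmation × Reciprocity

_⊗_ : {At : Set} → List (Form At) → List (Form At) → List (Form At)
A ⊗ B = concatMap (λ φ → map (λ ψ → φ ∧f ψ) B) A

_∧ˢ_ : {At : Set} → List (Form At) → Form At → List (Form At)
A ∧ˢ φ = map (λ ψ → ψ ∧f φ) A

module Believability {At : Set} (Cn : FSet At → FSet At) (K : FSet At)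
                     (_≼_ : List (Form At) → List (Form At) → Set) where

  _≃_ : List (Form At) → List (Form At) → Set
  A ≃ B = (A ≼ B) × (B ≼ A)

  _≺_ : List (Form At) → List (Form At) → Set
  A ≺ B = (A ≼ B) × ¬ (B ≼ A)

  Transitivity : Set
  Transitivity = ∀ A B C → A ≼ B → B ≼ C → A ≼ C

  -- {(φ ∧ ψ) ∧ χ | φ ∈ A, ψ ∈ B, χ ∈ C} is (A ⊗ B) ⊗ C
  WeakCoupling : Set
  WeakCoupling = ∀ A B C → A ≃ (A ⊗ B) → A ≃ (A ⊗ C) → A ≃ ((A ⊗ B) ⊗ C)

  CounterDominance : Set
  CounterDominance = ∀ A B →
    (∀ φ → φ ∈ B → ∃ λ ψ → ψ ∈ A × Cn ⟦ φ ∷ [] ⟧ ψ) → A ≼ B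

  Minimality : Set
  Minimality = ∀ A → ((∀ B → A ≼ B) → Meets A K) × (Meets A K → ∀ B → A ≼ B)

  Union : Set
  Union = ∀ A B → (A ≼ (A ++ B)) ⊎ (B ≼ (A ++ B))

  AllPostulates : Set
  AllPostulates = Transitivity × WeakCoupling × CounterDominance × Minimality × Union

  Revised : List (Form At) → FSet At
  Revised A φ = A ≃ (A ∧ˢ φ)

  Represents : (List (Form At) → FSet At) → Set
  Represents rev = ∀ A → (A ≺ [] → rev A ≐ Revised A) × (¬ (A ≺ []) → rev A ≐ K)

-- Consistency of K and compactness of Cn give excluded middle for every proposition, so the
-- argument may be classical. Given a revision, put A ≼ B when revising by A ∪ B selects an
-- element of A or selects nothing at all. Regularity and reciprocity show that revising by a set
-- B whose elements each entail an element of D, and which meets the revision by D, gives the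
-- revision by D; so inside any suitable superset, A ≼ B says that the revision meets A, and the
-- properties of ≼ and the representation follow.
-- Conversely, given ≼, weak coupling makes {φ | A ≃ A ∧ φ} closed under conjunction, hence
-- Cn-closed by compactness; union yields some ψ ∈ A with {ψ} ≼ A, and this ψ lies in that set;
-- and weak coupling again makes two revisions that meet each other's inputs coincide.
module Submission where

open import Defs
open import Data.Bool using (true; false; _∧_)
open import Data.Bool.Properties using (∧-assoc; ∧-idem; ∧-identityʳ; ∧-conicalˡ; ∧-conicalʳ)
open import Data.Empty using (⊥-elim)
open import Data.List using (List; []; _∷_; _++_; map; cartesianProductWith)
open import Data.List.Properties using (map-∘)
open import Data.List.Membership.Propositional using (_∈_)
open import Data.List.Membership.Propositional.Properties using (∈-map⁺; ∈-map⁻; ∈-++⁻; ∈-cartesianProductWith⁺; ∈-cartesianProductWith⁻)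
open import Data.List.Relation.Binary.Subset.Propositional using () renaming (_⊆_ to _⊆ₗ_)
open import Data.List.Relation.Binary.Subset.Propositional.Properties using (⊆-refl; xs⊆xs++ys; xs⊆ys++xs; ++⁺ʳ)
open import Data.List.Relation.Unary.Any using (here; there)
open import Data.Product using (Σ; ∃; ∃₂; _×_; _,_; proj₁; proj₂)
open import Data.Sum using (_⊎_; inj₁; inj₂)
open import Function using (_∘_)
open import Relation.Binary.PropositionalEquality using (_≡_; _≢_; refl; sym; trans; cong; subst; module ≡-Reasoning)
open import Relation.Nullary using (¬_)

private
  variable
    At : Set
    A B C D Φ : List (Form At)
    α β φ φ′ ψ ψ′ χ : Form At
    X Y Z : FSet At

false≢true : false ≢ true
false≢true ()

∧-true : ∀ {x y} → x ≡ true → y ≡ true → x ∧ y ≡ true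
∧-true refl refl = refl

≐-sym : X ≐ Y → Y ≐ X
≐-sym (X⊆Y , Y⊆X) = Y⊆X , X⊆Y

≐-trans : X ≐ Y → Y ≐ Z → X ≐ Z
≐-trans (X⊆Y , Y⊆X) (Y⊆Z , Z⊆Y) = (λ φ → Y⊆Z φ ∘ X⊆Y φ) , (λ φ → Y⊆X φ ∘ Z⊆Y φ)

⊤f : Form At
⊤f = ⊥f ⇒f ⊥f

⋀ : List (Form At) → Form At
⋀ []      = ⊤f
⋀ (φ ∷ Φ) = φ ∧f ⋀ Φ

⋀-true : ∀ v → eval v (⋀ Φ) ≡ true → φ ∈ Φ → eval v φ ≡ true
⋀-true v h (here refl)  = ∧-conicalˡ _ _ h
⋀-true v h (there φ∈Φ) = ⋀-true v (∧-conicalʳ _ _ h) φ∈Φ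

⊗-cartesianProduct : (A B : List (Form At)) → A ⊗ B ≡ cartesianProductWith _∧f_ A B
⊗-cartesianProduct []      B = refl
⊗-cartesianProduct (φ ∷ A) B = cong (map (φ ∧f_) B ++_) (⊗-cartesianProduct A B)

∈-⊗⁺ : φ ∈ A → ψ ∈ B → φ ∧f ψ ∈ A ⊗ B
∈-⊗⁺ {A = A} {B = B} φ∈A ψ∈B =
  subst (_ ∈_) (sym (⊗-cartesianProduct A B)) (∈-cartesianProductWith⁺ _∧f_ φ∈A ψ∈B)

∈-⊗⁻ : (A B : List (Form At)) → χ ∈ A ⊗ B → ∃₂ λ φ ψ → φ ∈ A × ψ ∈ B × χ ≡ φ ∧f ψ
∈-⊗⁻ A B rewrite ⊗-cartesianProduct A B = ∈-cartesianProductWith⁻ _∧f_ A B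

⊗-singleton : (A : List (Form At)) (φ : Form At) → A ⊗ (φ ∷ []) ≡ A ∧ˢ φ
⊗-singleton []      φ = refl
⊗-singleton (ψ ∷ A) φ = cong (ψ ∧f φ ∷_) (⊗-singleton A φ)

⊗-singleton² : (A : List (Form At)) (φ ψ : Form At) →
               (A ⊗ (φ ∷ [])) ⊗ (ψ ∷ []) ≡ map (λ χ → (χ ∧f φ) ∧f ψ) A
⊗-singleton² A φ ψ = begin
  (A ⊗ (φ ∷ [])) ⊗ (ψ ∷ [])  ≡⟨ ⊗-singleton (A ⊗ (φ ∷ [])) ψ ⟩
  (A ⊗ (φ ∷ [])) ∧ˢ ψ        ≡⟨ cong (_∧ˢ ψ) (⊗-singleton A φ) ⟩
  (A ∧ˢ φ) ∧ˢ ψ              ≡⟨ map-∘ A ⟨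
  map (λ χ → (χ ∧f φ) ∧f ψ) A ∎
  where open ≡-Reasoning

++-⊆ : A ⊆ₗ C → B ⊆ₗ C → A ++ B ⊆ₗ C
++-⊆ {A = A} A⊆C B⊆C φ∈A++B with ∈-++⁻ A φ∈A++B
... | inj₁ φ∈A = A⊆C φ∈A
... | inj₂ φ∈B = B⊆C φ∈B

Meets-⊆ : A ⊆ₗ B → Meets A X → Meets B X
Meets-⊆ A⊆B (φ , φ∈A , Xφ) = φ , A⊆B φ∈A , Xφ

Meets-mono : X ⊆ Y → Meets A X → Meets A Y
Meets-mono X⊆Y (φ , φ∈A , Xφ) = φ , φ∈A , X⊆Y φ Xφ

Meets-++⁻ : (A : List (Form At)) → Meets (A ++ B) X → Meets A X ⊎ Meets B X
Meets-++⁻ A (φ , φ∈A++B , Xφ) with ∈-++⁻ A φ∈A++B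
... | inj₁ φ∈A = inj₁ (φ , φ∈A , Xφ)
... | inj₂ φ∈B = inj₂ (φ , φ∈B , Xφ)

module _ {Cn : FSet At → FSet At} (isC : IsConsequence Cn) where
  open IsConsequence isC

  infix 4 _⊢_
  _⊢_ : Form At → Form At → Set
  φ ⊢ ψ = Cn ⟦ φ ∷ [] ⟧ ψ

  Closed : FSet At → Set
  Closed X = Cn X ⊆ X

  ⊨⇒⊢ : (∀ v → eval v φ ≡ true → eval v ψ ≡ true) → φ ⊢ ψ
  ⊨⇒⊢ {φ = φ} sem = supraclassical _ _ (λ v h → sem v (h φ (here refl)))

  Cn-cut : ⟦ Φ ⟧ ⊆ Cn X → Cn ⟦ Φ ⟧ φ → Cn X φ
  Cn-cut {Φ = Φ} {X = X} {φ = φ} Φ⊆CnX c = iteration X φ (monotony ⟦ Φ ⟧ (Cn X) Φ⊆CnX φ c)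

  Cn-closed : Closed (Cn X)
  Cn-closed {X = X} = iteration X

  closed-⊢ : Closed X → X φ → φ ⊢ ψ → X ψ
  closed-⊢ {X = X} cl Xφ φ⊢ψ = cl _ (Cn-cut (λ { _ (here refl) → inclusion X _ Xφ }) φ⊢ψ)

  closed-∧ : Closed X → X φ → X ψ → X (φ ∧f ψ)
  closed-∧ {X = X} {φ = φ} {ψ = ψ} cl Xφ Xψ = cl _ (Cn-cut premises (supraclassical _ _ sem))
    where
    premises : ⟦ φ ∷ ψ ∷ [] ⟧ ⊆ Cn X
    premises _ (here refl)         = inclusion X φ Xφ
    premises _ (there (here refl)) = inclusion X ψ Xψ
    sem : ⟦ φ ∷ ψ ∷ [] ⟧ ⊨ (φ ∧f ψ)
    sem v h = ∧-true (h φ (here refl)) (h ψ (there (here refl)))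

  closed-⊤ : Closed X → X ⊤f
  closed-⊤ cl = cl _ (supraclassical _ _ (λ _ _ → refl))

  closed-≐ : X ≐ Y → Closed Y → Cn X ≐ X
  closed-≐ {X = X} {Y = Y} (X⊆Y , Y⊆X) clY =
    (λ φ → Y⊆X φ ∘ clY φ ∘ monotony X Y X⊆Y φ) , inclusion X

  ⊢-refl : φ ⊢ φ
  ⊢-refl = inclusion _ _ (here refl)

  ⊢-trans : φ ⊢ ψ → ψ ⊢ χ → φ ⊢ χ
  ⊢-trans = closed-⊢ Cn-closed

  ∧-elimˡ : φ ∧f ψ ⊢ φ
  ∧-elimˡ = ⊨⇒⊢ (λ _ → ∧-conicalˡ _ _)

  ∧-elimʳ : φ ∧f ψ ⊢ ψ
  ∧-elimʳ = ⊨⇒⊢ (λ _ → ∧-conicalʳ _ _)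

  ∧-mono-⊢ : φ ⊢ φ′ → ψ ⊢ ψ′ → φ ∧f ψ ⊢ φ′ ∧f ψ′
  ∧-mono-⊢ φ⊢φ′ ψ⊢ψ′ = closed-∧ Cn-closed (⊢-trans ∧-elimˡ φ⊢φ′) (⊢-trans ∧-elimʳ ψ⊢ψ′)

  ⋀-⊢ : Cn ⟦ Φ ⟧ φ → ⋀ Φ ⊢ φ
  ⋀-⊢ = Cn-cut (λ _ ψ∈Φ → ⊨⇒⊢ (λ v h → ⋀-true v h ψ∈Φ))

  -- {⊥f | P} classically entails ⊥f as soon as ¬ ¬ P; by compactness some finite part of it
  -- already yields ⊥f, and that part is nonempty because X is consistent.
  consistent⇒stable : ¬ Cn X ⊥f → (P : Set) → ¬ ¬ P → P
  consistent⇒stable {X = X} consistent P ¬¬P =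
    witness (compact ⊥-if-P ⊥f (supraclassical ⊥-if-P ⊥f ⊥-entailed))
    where
    ⊥-if-P : FSet At
    ⊥-if-P φ = P × φ ≡ ⊥f
    ⊥-entailed : ⊥-if-P ⊨ ⊥f
    ⊥-entailed v h = ⊥-elim (¬¬P (λ p → false≢true (h ⊥f (p , refl))))
    witness : Σ (List (Form At)) (λ Φ → ⟦ Φ ⟧ ⊆ ⊥-if-P × Cn ⟦ Φ ⟧ ⊥f) → P
    witness ([]    , _   , ⊢⊥) = ⊥-elim (consistent (monotony ⟦ [] ⟧ X (λ _ ()) ⊥f ⊢⊥))
    witness (_ ∷ _ , Φ⊆ , _)  = proj₁ (Φ⊆ _ (here refl))

  consistent⇒em : ¬ Cn X ⊥f → (P : Set) → P ⊎ ¬ P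
  consistent⇒em consistent P = consistent⇒stable consistent _ (λ ¬em → ¬em (inj₂ (¬em ∘ inj₁)))

  Dominates : List (Form At) → List (Form At) → Set
  Dominates A B = ∀ φ → φ ∈ B → ∃ λ ψ → ψ ∈ A × φ ⊢ ψ

  dominates-⊇ : B ⊆ₗ A → Dominates A B
  dominates-⊇ B⊆A φ φ∈B = φ , B⊆A φ∈B , ⊢-refl

  dominates-trans : Dominates A B → Dominates B C → Dominates A C
  dominates-trans A≫B B≫C φ φ∈C with B≫C φ φ∈C
  ... | ψ , ψ∈B , φ⊢ψ with A≫B ψ ψ∈B
  ...   | χ , χ∈A , ψ⊢χ = χ , χ∈A , ⊢-trans φ⊢ψ ψ⊢χ

  dominates-++ : Dominates A B → Dominates A C → Dominates A (B ++ C)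
  dominates-++ {B = B} A≫B A≫C φ φ∈B++C with ∈-++⁻ B φ∈B++C
  ... | inj₁ φ∈B = A≫B φ φ∈B
  ... | inj₂ φ∈C = A≫C φ φ∈C

  dominates-++-self : Dominates A B → Dominates A (B ++ A)
  dominates-++-self A≫B = dominates-++ A≫B (dominates-⊇ ⊆-refl)

  dominates-map : {f : Form At → Form At} →
                  (∀ φ → φ ∈ B → ∃ λ ψ → ψ ∈ A × f φ ⊢ ψ) → Dominates A (map f B)
  dominates-map {f = f} h _ χ∈fB with ∈-map⁻ f χ∈fB
  ... | φ , φ∈B , refl = h φ φ∈B

  dominates-map-map : {f g : Form At → Form At} → (∀ φ → f φ ⊢ g φ) → Dominates (map g A) (map f A)
  dominates-map-map {g = g} f⊢g = dominates-map (λ φ φ∈A → g φ , ∈-map⁺ g φ∈A , f⊢g φ)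

  dominates-∧ˢ : Dominates A (A ∧ˢ φ)
  dominates-∧ˢ = dominates-map (λ ψ ψ∈A → ψ , ψ∈A , ∧-elimˡ)

  dominates-∧ˢ-of-∈ : φ ∈ A → Dominates A (B ∧ˢ φ)
  dominates-∧ˢ-of-∈ {φ = φ} φ∈A = dominates-map (λ _ _ → φ , φ∈A , ∧-elimʳ)

  dominates-⊗ : Dominates A (A ⊗ B)
  dominates-⊗ {A = A} {B = B} χ χ∈A⊗B with ∈-⊗⁻ A B χ∈A⊗B
  ... | φ , _ , φ∈A , _ , refl = φ , φ∈A , ∧-elimˡ

  meets-dominated : Closed X → Dominates A B → Meets B X → Meets A X
  meets-dominated cl A≫B (φ , φ∈B , Xφ) with A≫B φ φ∈B
  ... | ψ , ψ∈A , φ⊢ψ = ψ , ψ∈A , closed-⊢ cl Xφ φ⊢ψ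

  module FromRevision (K : FSet At) (K-closed : Closed K) (K-consistent : ¬ Cn K ⊥f)
                      (rev : List (Form At) → FSet At)
                      (closure : Revision.Closure Cn K rev)
                      (relative-success : Revision.RelativeSuccess Cn K rev)
                      (regularity : Revision.Regularity Cn K rev)
                      (confirmation : Revision.Confirmation Cn K rev)
                      (reciprocity : Revision.Reciprocity Cn K rev) where

    em : (P : Set) → P ⊎ ¬ P
    em = consistent⇒em K-consistent

    Successful : List (Form At) → Set
    Successful A = Meets A (rev A)

    rev-closed : ∀ A → Closed (rev A)
    rev-closed A = proj₁ (closure A)

    successful-⊆ : A ⊆ₗ B → Successful A → Successful B
    successful-⊆ {B = B} A⊆B sA = regularity B _ (Meets-⊆ A⊆B sA)

    successful-dominates : Dominates A B → Successful B → Successful A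
    successful-dominates {A = A} {B = B} A≫B sB = regularity A B (meets-dominated (rev-closed B) A≫B sB)

    rev-≐-dominated : Dominates A B → Meets B (rev A) → rev A ≐ rev B
    rev-≐-dominated {A = A} {B = B} A≫B m =
      reciprocity A B m (meets-dominated (rev-closed B) A≫B (regularity B A m))

    infix 4 _≼_
    _≼_ : List (Form At) → List (Form At) → Set
    A ≼ B = Meets A (rev (A ++ B)) ⊎ ¬ Successful (A ++ B)

    open Believability Cn K _≼_

    ≼⇒meets : Dominates D (A ++ B) → Meets B (rev D) → A ≼ B → Meets A (rev D)
    ≼⇒meets {D = D} {A = A} {B = B} D≫A++B mB = meets
      where
      mA++B : Meets (A ++ B) (rev D)
      mA++B = Meets-⊆ (xs⊆ys++xs B A) mB
      rev-D≐ : rev D ≐ rev (A ++ B)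
      rev-D≐ = rev-≐-dominated D≫A++B mA++B
      meets : A ≼ B → Meets A (rev D)
      meets (inj₁ mA)  = Meets-mono (proj₂ rev-D≐) mA
      meets (inj₂ ¬sA) = ⊥-elim (¬sA (Meets-mono (proj₁ rev-D≐) mA++B))

    meets⇒≼ : Dominates D (A ++ B) → Meets A (rev D) → A ≼ B
    meets⇒≼ {A = A} {B = B} D≫A++B mA =
      inj₁ (Meets-mono (proj₁ (rev-≐-dominated D≫A++B (Meets-⊆ (xs⊆xs++ys A B) mA))) mA)

    ≼-counterDominance : CounterDominance
    ≼-counterDominance A B A≫B with em (Successful (A ++ B))
    ... | inj₁ s  = inj₁ (meets-dominated (rev-closed _) (dominates-++ (dominates-⊇ ⊆-refl) A≫B) s)
    ... | inj₂ ¬s = inj₂ ¬s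

    ≼-transitive : Transitivity
    ≼-transitive A B C A≼B B≼C with em (Successful (A ++ C))
    ... | inj₂ ¬s = inj₂ ¬s
    ... | inj₁ s  = meets⇒≼ (dominates-⊇ A++C⊆D′) A-meets
      where
      D′ = A ++ B ++ C
      A++C⊆D′ : A ++ C ⊆ₗ D′
      A++C⊆D′ = ++⁺ʳ A (xs⊆ys++xs C B)
      via-A≼B : Meets B (rev D′) → Meets A (rev D′)
      via-A≼B mB = ≼⇒meets (dominates-⊇ (++⁺ʳ A (xs⊆xs++ys B C))) mB A≼B
      A-meets : Meets A (rev D′)
      A-meets with Meets-++⁻ A (successful-⊆ A++C⊆D′ s)
      ... | inj₁ mA  = mA
      ... | inj₂ mBC with Meets-++⁻ B mBC
      ...   | inj₁ mB = via-A≼B mB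
      ...   | inj₂ mC = via-A≼B (≼⇒meets (dominates-⊇ (xs⊆ys++xs (B ++ C) A)) mC B≼C)

    ≼-weakCoupling : WeakCoupling
    ≼-weakCoupling A B C (_ , A⊗B≼A) (_ , A⊗C≼A) = ≼-counterDominance A T A≫T , T≼A
      where
      T = (A ⊗ B) ⊗ C
      A≫T : Dominates A T
      A≫T = dominates-trans dominates-⊗ dominates-⊗
      T≼A : T ≼ A
      T≼A with em (Successful A)
      ... | inj₂ ¬s = inj₂ (¬s ∘ successful-dominates (dominates-++-self A≫T))
      ... | inj₁ s  with ≼⇒meets (dominates-++-self dominates-⊗) s A⊗B≼A
                       | ≼⇒meets (dominates-++-self dominates-⊗) s A⊗C≼A
      ...   | χ , χ∈A⊗B , rχ | ξ , ξ∈A⊗C , rξ with ∈-⊗⁻ A C ξ∈A⊗C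
      ...     | _ , γ , _ , γ∈C , refl =
                meets⇒≼ (dominates-++-self A≫T)
                  (χ ∧f γ , ∈-⊗⁺ χ∈A⊗B γ∈C , closed-∧ (rev-closed A) rχ (closed-⊢ (rev-closed A) rξ ∧-elimʳ))

    ≼-minimality : Minimality
    ≼-minimality A = least⇒meets , meets⇒least
      where
      ⊤∈K : K ⊤f
      ⊤∈K = closed-⊤ K-closed
      rev-A⊤≐K : rev (A ++ ⊤f ∷ []) ≐ K
      rev-A⊤≐K = confirmation _ (⊤f , xs⊆ys++xs _ A (here refl) , ⊤∈K)
      least⇒meets : (∀ B → A ≼ B) → Meets A K
      least⇒meets A-least with A-least (⊤f ∷ [])
      ... | inj₁ m  = Meets-mono (proj₁ rev-A⊤≐K) m
      ... | inj₂ ¬s = ⊥-elim (¬s (⊤f , xs⊆ys++xs _ A (here refl) , proj₂ rev-A⊤≐K ⊤f ⊤∈K))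
      meets⇒least : Meets A K → ∀ B → A ≼ B
      meets⇒least m B = inj₁ (Meets-mono (proj₂ (confirmation (A ++ B) (Meets-⊆ (xs⊆xs++ys A B) m))) m)

    ≼-union : Union
    ≼-union A B with em (Successful (A ++ B))
    ... | inj₂ ¬s = inj₁ (inj₂ (¬s ∘ successful-dominates (dominates-⊇ (++-⊆ (xs⊆xs++ys A B) ⊆-refl))))
    ... | inj₁ s with Meets-++⁻ A s
    ...   | inj₁ mA = inj₁ (meets⇒≼ (dominates-⊇ (++-⊆ (xs⊆xs++ys A B) ⊆-refl)) mA)
    ...   | inj₂ mB = inj₂ (meets⇒≼ (dominates-⊇ (++-⊆ (xs⊆ys++xs B A) ⊆-refl)) mB)

    successful⇒≺[] : Successful A → A ≺ []
    successful⇒≺[] {A = A} s = ≼-counterDominance A [] (λ _ ()) , λ { (inj₁ (_ , () , _)) ; (inj₂ ¬s) → ¬s s }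

    ≺[]⇒successful : A ≺ [] → Successful A
    ≺[]⇒successful (_ , ¬[]≼A) = consistent⇒stable K-consistent _ (¬[]≼A ∘ inj₂)

    rev-≐-Revised : Successful A → rev A ≐ Revised A
    rev-≐-Revised {A = A} s@(α , α∈A , rα) = rev⊆Revised , Revised⊆rev
      where
      A≫A∧ˢ-++A : ∀ φ → Dominates A ((A ∧ˢ φ) ++ A)
      A≫A∧ˢ-++A φ = dominates-++-self dominates-∧ˢ
      rev⊆Revised : rev A ⊆ Revised A
      rev⊆Revised φ rφ =
        ≼-counterDominance A _ dominates-∧ˢ ,
        meets⇒≼ (A≫A∧ˢ-++A φ) (α ∧f φ , ∈-map⁺ (_∧f φ) α∈A , closed-∧ (rev-closed A) rα rφ)
      Revised⊆rev : Revised A ⊆ rev A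
      Revised⊆rev φ (_ , A∧ˢφ≼A) with ≼⇒meets (A≫A∧ˢ-++A φ) s A∧ˢφ≼A
      ... | χ , χ∈A∧ˢφ , rχ with ∈-map⁻ (_∧f φ) χ∈A∧ˢφ
      ...   | _ , _ , refl = closed-⊢ (rev-closed A) rχ ∧-elimʳ

    ≼-represents : Represents rev
    ≼-represents A = rev-≐-Revised ∘ ≺[]⇒successful , unsuccessful
      where
      unsuccessful : ¬ A ≺ [] → rev A ≐ K
      unsuccessful ¬≺ with relative-success A
      ... | inj₁ rev-A≐K = rev-A≐K
      ... | inj₂ s       = ⊥-elim (¬≺ (successful⇒≺[] s))

    believability : Σ (List (Form At) → List (Form At) → Set)
                      (λ _≼′_ → Believability.AllPostulates Cn K _≼′_ × Believability.Represents Cn K _≼′_ rev)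
    believability = _≼_ , (≼-transitive , ≼-weakCoupling , ≼-counterDominance , ≼-minimality , ≼-union) , ≼-represents

  module FromBelievability (K : FSet At) (K-closed : Closed K) (K-consistent : ¬ Cn K ⊥f)
                           (rev : List (Form At) → FSet At)
                           (_≼_ : List (Form At) → List (Form At) → Set)
                           (transitivity : Believability.Transitivity Cn K _≼_)
                           (weak-coupling : Believability.WeakCoupling Cn K _≼_)
                           (counter-dominance : Believability.CounterDominance Cn K _≼_)
                           (minimality : Believability.Minimality Cn K _≼_)
                           (union : Believability.Union Cn K _≼_)
                           (represents : Believability.Represents Cn K _≼_ rev) where
    open Believability Cn K _≼_

    ≼-trans : A ≼ B → B ≼ C → A ≼ C
    ≼-trans = transitivity _ _ _

    ≼-dominated : Dominates A B → A ≼ B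
    ≼-dominated = counter-dominance _ _

    ≼-refl : A ≼ A
    ≼-refl = ≼-dominated (dominates-⊇ ⊆-refl)

    ≼-[] : A ≼ []
    ≼-[] = ≼-dominated (λ _ ())

    revised-intro : (A ∧ˢ φ) ≼ A → Revised A φ
    revised-intro A∧ˢφ≼A = ≼-dominated dominates-∧ˢ , A∧ˢφ≼A

    coupling : Revised A φ → Revised A ψ → map (λ χ → (χ ∧f φ) ∧f ψ) A ≼ A
    coupling {A = A} {φ = φ} {ψ = ψ} rφ rψ =
      subst (_≼ A) (⊗-singleton² A φ ψ) (proj₂ (weak-coupling A (φ ∷ []) (ψ ∷ []) (as-⊗ rφ) (as-⊗ rψ)))
      where
      as-⊗ : ∀ {φ} → Revised A φ → A ≃ (A ⊗ (φ ∷ []))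
      as-⊗ {φ} = subst (A ≃_) (sym (⊗-singleton A φ))

    revised-⊤ : Revised A ⊤f
    revised-⊤ = revised-intro (≼-dominated (λ α α∈A →
      α ∧f ⊤f , ∈-map⁺ (_∧f ⊤f) α∈A , ⊨⇒⊢ (λ v → trans (∧-identityʳ (eval v α)))))

    revised-∧ : Revised A φ → Revised A ψ → Revised A (φ ∧f ψ)
    revised-∧ rφ rψ = revised-intro (≼-trans (≼-dominated (dominates-map-map (λ _ → assoc))) (coupling rφ rψ))
      where
      assoc : (χ ∧f φ) ∧f ψ ⊢ χ ∧f (φ ∧f ψ)
      assoc {χ} = ⊨⇒⊢ (λ v → trans (sym (∧-assoc (eval v χ) _ _)))

    revised-⋀ : ⟦ Φ ⟧ ⊆ Revised A → Revised A (⋀ Φ)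
    revised-⋀ {Φ = []}    _    = revised-⊤
    revised-⋀ {Φ = φ ∷ Φ} Φ⊆ = revised-∧ (Φ⊆ φ (here refl)) (revised-⋀ (λ ψ → Φ⊆ ψ ∘ there))

    revised-⊢ : Revised A φ → φ ⊢ ψ → Revised A ψ
    revised-⊢ (_ , A∧ˢφ≼A) φ⊢ψ =
      revised-intro (≼-trans (≼-dominated (dominates-map-map (λ _ → ∧-mono-⊢ ⊢-refl φ⊢ψ))) A∧ˢφ≼A)

    revised-closed : Closed (Revised A)
    revised-closed {A = A} φ c with compact (Revised A) φ c
    ... | Φ , Φ⊆ , Φ⊢φ = revised-⊢ (revised-⋀ Φ⊆) (⋀-⊢ Φ⊢φ)

    revised-⊆ : β ∈ B → Revised A β → α ∈ A → Revised B α → Revised A ⊆ Revised B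
    revised-⊆ {β = β} {B = B} {A = A} β∈B rβ α∈A (_ , B∧ˢα≼B) φ rφ =
      revised-intro (≼-trans (≼-dominated B∧ˢφ≫) (≼-trans (coupling rβ rφ) A≼B))
      where
      A≼B : A ≼ B
      A≼B = ≼-trans (≼-dominated (dominates-∧ˢ-of-∈ α∈A)) B∧ˢα≼B
      B∧ˢφ≫ : Dominates (B ∧ˢ φ) (map (λ χ → (χ ∧f β) ∧f φ) A)
      B∧ˢφ≫ = dominates-map (λ _ _ → β ∧f φ , ∈-map⁺ (_∧f φ) β∈B , ∧-mono-⊢ ∧-elimʳ ⊢-refl)

    []≼-transfer : [] ≼ A → φ ∈ A → Revised B φ → [] ≼ B
    []≼-transfer {φ = φ} []≼A φ∈A (_ , B∧ˢφ≼B) =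
      ≼-trans []≼A (≼-trans (≼-dominated (dominates-⊇ φ∈-only))
                            (≼-trans (≼-dominated (dominates-∧ˢ-of-∈ (here refl))) B∧ˢφ≼B))
      where
      φ∈-only : φ ∷ [] ⊆ₗ _
      φ∈-only (here refl) = φ∈A

    ≼-singleton : ∀ ψ Ψ → ∃ λ φ → φ ∈ ψ ∷ Ψ × (φ ∷ []) ≼ (ψ ∷ Ψ)
    ≼-singleton ψ []      = ψ , here refl , ≼-refl
    ≼-singleton ψ (χ ∷ Ψ) with union (ψ ∷ []) (χ ∷ Ψ)
    ... | inj₁ ψ≼ = ψ , here refl , ψ≼
    ... | inj₂ χΨ≼ with ≼-singleton χ Ψ
    ...   | φ , φ∈χΨ , φ≼χΨ = φ , there φ∈χΨ , ≼-trans φ≼χΨ χΨ≼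

    revised-meets : ¬ [] ≼ A → Meets A (Revised A)
    revised-meets {A = []}    ¬[]≼A = ⊥-elim (¬[]≼A ≼-refl)
    revised-meets {A = ψ ∷ Ψ} _ with ≼-singleton ψ Ψ
    ... | φ , φ∈A , φ≼A = φ , φ∈A , revised-intro (≼-trans (≼-dominated A∧ˢφ≫φ) φ≼A)
      where
      A∧ˢφ≫φ : Dominates ((ψ ∷ Ψ) ∧ˢ φ) (φ ∷ [])
      A∧ˢφ≫φ _ (here refl) = φ ∧f φ , ∈-map⁺ (_∧f φ) φ∈A , ⊨⇒⊢ (λ v → trans (∧-idem (eval v φ)))

    revised-≐-K : Meets A K → Revised A ≐ K
    revised-≐-K {A = A} mK@(α , α∈A , Kα) = Revised⊆K , K⊆Revised
      where
      Revised⊆K : Revised A ⊆ K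
      Revised⊆K φ (_ , A∧ˢφ≼A) with proj₁ (minimality (A ∧ˢ φ)) (≼-trans A∧ˢφ≼A ∘ proj₂ (minimality A) mK)
      ... | χ , χ∈A∧ˢφ , Kχ with ∈-map⁻ (_∧f φ) χ∈A∧ˢφ
      ...   | _ , _ , refl = closed-⊢ K-closed Kχ ∧-elimʳ
      K⊆Revised : K ⊆ Revised A
      K⊆Revised φ Kφ =
        revised-intro (proj₂ (minimality (A ∧ˢ φ)) (α ∧f φ , ∈-map⁺ (_∧f φ) α∈A , closed-∧ K-closed Kα Kφ) A)

    data Revisability (A : List (Form At)) : Set where
      revisable   : ¬ [] ≼ A → rev A ≐ Revised A → Revisability A
      unrevisable : [] ≼ A → rev A ≐ K → Revisability A

    -- A ≺ [] amounts to ¬ [] ≼ A, since A ≼ [] always holds.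
    revisability : ∀ A → Revisability A
    revisability A with consistent⇒em K-consistent ([] ≼ A)
    ... | inj₁ []≼A  = unrevisable []≼A (proj₂ (represents A) (λ A≺[] → proj₂ A≺[] []≼A))
    ... | inj₂ ¬[]≼A = revisable ¬[]≼A (proj₁ (represents A) (≼-[] , ¬[]≼A))

    open Revision Cn K rev

    rev-closure : Closure
    rev-closure A with revisability A
    ... | revisable _ rev-A≐   = closed-≐ rev-A≐ revised-closed
    ... | unrevisable _ rev-A≐ = closed-≐ rev-A≐ K-closed

    rev-relativeSuccess : RelativeSuccess
    rev-relativeSuccess A with revisability A
    ... | revisable ¬[]≼A rev-A≐ = inj₂ (Meets-mono (proj₂ rev-A≐) (revised-meets ¬[]≼A))
    ... | unrevisable _ rev-A≐   = inj₁ rev-A≐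

    rev-regularity : Regularity
    rev-regularity A B (φ , φ∈A , rev-Bφ) with revisability A | revisability B
    ... | revisable ¬[]≼A rev-A≐ | _ = Meets-mono (proj₂ rev-A≐) (revised-meets ¬[]≼A)
    ... | unrevisable []≼A _ | revisable ¬[]≼B rev-B≐ =
          ⊥-elim (¬[]≼B ([]≼-transfer []≼A φ∈A (proj₁ rev-B≐ φ rev-Bφ)))
    ... | unrevisable _ rev-A≐ | unrevisable _ rev-B≐ = φ , φ∈A , proj₂ rev-A≐ φ (proj₁ rev-B≐ φ rev-Bφ)

    rev-confirmation : Confirmation
    rev-confirmation A mK with revisability A
    ... | revisable _ rev-A≐   = ≐-trans rev-A≐ (revised-≐-K mK)
    ... | unrevisable _ rev-A≐ = rev-A≐

    rev-reciprocity : Reciprocity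
    rev-reciprocity A B (β , β∈B , rev-Aβ) (α , α∈A , rev-Bα) with revisability A | revisability B
    ... | revisable _ rev-A≐ | revisable _ rev-B≐ =
          ≐-trans rev-A≐ (≐-trans (revised-⊆ β∈B rβ α∈A rα , revised-⊆ α∈A rα β∈B rβ) (≐-sym rev-B≐))
      where
      rβ = proj₁ rev-A≐ β rev-Aβ
      rα = proj₁ rev-B≐ α rev-Bα
    ... | revisable ¬[]≼A rev-A≐ | unrevisable []≼B _ =
          ⊥-elim (¬[]≼A ([]≼-transfer []≼B β∈B (proj₁ rev-A≐ β rev-Aβ)))
    ... | unrevisable []≼A _ | revisable ¬[]≼B rev-B≐ =
          ⊥-elim (¬[]≼B ([]≼-transfer []≼A α∈A (proj₁ rev-B≐ α rev-Bα)))
    ... | unrevisable _ rev-A≐ | unrevisable _ rev-B≐ = ≐-trans rev-A≐ (≐-sym rev-B≐)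

    revision : Revision.AllPostulates Cn K rev
    revision = rev-closure , rev-relativeSuccess , rev-regularity , rev-confirmation , rev-reciprocity

theorem4 : {At : Set} (Cn : FSet At → FSet At) → IsConsequence Cn →
    (K : FSet At) → Cn K ≐ K → ¬ (Cn K ⊥f) →
    (rev : List (Form At) → FSet At) →
    (Revision.AllPostulates Cn K rev →
       Σ (List (Form At) → List (Form At) → Set) (λ _≼_ →
         Believability.AllPostulates Cn K _≼_ × Believability.Represents Cn K _≼_ rev))
    × (Σ (List (Form At) → List (Form At) → Set) (λ _≼_ →
         Believability.AllPostulates Cn K _≼_ × Believability.Represents Cn K _≼_ rev)
       → Revision.AllPostulates Cn K rev)
theorem4 Cn isC K (K-closed , _) K-consistent rev =
  (λ (closure , relative-success , regularity , confirmation , reciprocity) →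
     FromRevision.believability isC K K-closed K-consistent rev
       closure relative-success regularity confirmation reciprocity) ,
  (λ (_≼_ , (transitivity , weak-coupling , counter-dominance , minimality , union) , represents) →
     FromBelievability.revision isC K K-closed K-consistent rev _≼_
       transitivity weak-coupling counter-dominance minimality union represents)
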